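{- Let $(f_n)_{n\in\mathbb N}$ be a Boolean function family. Then $(f_n)\in\mathbf{NP}_{\mathrm{IS}}$ if and only if there exist a polynomial $h:\mathbb N\to\mathbb N$ and a Boolean function family $(g_n)_{n\in\mathbb N}\in\mathbf P_{\mathrm{IS}}$ such that for all $n\in\mathbb N$ and all $w\in\mathbb B^n$: $f_n(w)=\mathsf T\iff\exists c\in\mathbb B^*\,\bigl(|c|\le h(n)\wedge g_{|w\diamond c|}(w\diamond c)=\mathsf T\bigr)$.
   Context: Let $\mathbb B=\{\mathsf T,\mathsf F\}$. For $w=(b_1,\dots,b_n)$ and $c=(c_1,\dots,c_m)$ in $\mathbb B^*$, $w\diamond c=(b_1,b_1,\dots,b_n,b_n,\mathsf T,\mathsf F,c_1,\dots,c_m)$. There are Boolean registers named $\mathtt{in}{:}i$, $\mathtt{aux}{:}i$ ($i\ge1$) and $\mathtt{out}$, processing methods $\mathtt{set{:}T}$ (content becomes $\mathsf T$, reply $\mathsf T$), $\mathtt{set{:}F}$ (content becomes $\mathsf F$, reply $\mathsf F$), $\mathtt{get}$ (no change, reply is the content). Basic instructions are $f.m$. Primitive instructions: for each basic instruction $a$, the plain instruction $a$, positive test $+a$, negative test $-a$; forward jumps $\#l$ ($l\in\mathbb N$); termination $!$. An instruction sequence is a finite non-empty sequence $X=u_1;\dots;u_k$ of primitive instructions, $|X|=k$. Execution starts at $u_1$: $a$ executes $a$ and proceeds with the next instruction; $+a$ executes $a$ and proceeds with the next instruction if the reply is $\mathsf T$, otherwise skips the next instruction and proceeds with the one after; $-a$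 likewise with reply roles reversed; $\#l$ proceeds with the $l$-th next instruction ($\#0$ causes inaction); $!$ terminates; if there is no instruction to proceed with, inaction occurs. $\mathcal{IS}_{br}$ is the set of instruction sequences whose basic instructions are all of the forms $\mathtt{in}{:}i.\mathtt{get}$, $\mathtt{aux}{:}i.\mathtt{get}$, $\mathtt{aux}{:}i.\mathtt{set{:}}b$, $\mathtt{out}.\mathtt{set{:}}b$. $X$ computes $f:\mathbb B^n\to\mathbb B$ if for all $b_1,\dots,b_n$, executing $X$ with $\mathtt{in}{:}i$ initially $b_i$ ($i\le n$) and all auxiliary registers and $\mathtt{out}$ initially $\mathsf F$, execution never executes an instruction on $\mathtt{in}{:}i$ with $i>n$, ends by executing $!$, and leaves $f(b_1,\dots,b_n)$ in $\mathtt{out}$. A Boolean function family is a sequence $(f_n)_{n\in\mathbb N}$ with $f_n:\mathbb B^n\to\mathbb B$. $\mathbf P_{\mathrm{IS}}$ is the class of families $(g_n)$ for which there is a polynomial $h$ such that for every $n$ some $X\in\mathcal{IS}_{br}$ computes $g_n$ with $|X|\le h(n)$. $\mathbf{NP}_{\mathrm{IS}}$ is the class of families $(f_n)$ for which there exist a monotonic polynomial $h:\mathbb N\to\mathbb N$ and $(g_n)\in\mathbf P_{\mathrm{IS}}$ such that for all $n$ and $w\in\mathbb B^n$: $f_n(w)=\mathsf T\iff\exists c\in\mathbb B^{h(n)}\,g_{n+h(n)}(wc)=\mathsf T$ ($wc$ is concatenation). -}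

module Defs where

open import Data.Bool using (Bool; true; false; if_then_else_)
open import Data.Nat using (ℕ; zero; suc; _+_; _*_; _^_; _≤_; _<?_)
open import Data.Nat.Properties using (_≟_)
open import Data.List using (List; []; _∷_; drop; length)
open import Data.List.NonEmpty using (List⁺; toList)
open import Data.Vec using (Vec; []; _∷_; lookup; _++_)
open import Data.Fin using (fromℕ<)
open import Data.Product using (Σ; ∃; _×_; _,_)
open import Relation.Nullary using (yes; no)
open import Relation.Binary.PropositionalEquality using (_≡_)
open import Function.Bundles using (_⇔_)

-- Booleans: T = true, F = false.
𝔹 : Set
𝔹 = Bool

-- Basic instructions of IS_br.  Register indices i ≥ 1 are encoded by
-- k : ℕ with i = suc k, i.e. `inGet k` is in:(k+1).get, etc.

data BasicInstr : Set where
  inGet  : ℕ → BasicInstr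
  auxGet : ℕ → BasicInstr
  auxSet : ℕ → 𝔹 → BasicInstr
  outSet : 𝔹 → BasicInstr

data PrimInstr : Set where
  plain : BasicInstr → PrimInstr
  ptest : BasicInstr → PrimInstr
  ntest : BasicInstr → PrimInstr
  jump  : ℕ → PrimInstr
  halt  : PrimInstr

IS : Set
IS = List⁺ PrimInstr

∣_∣ : IS → ℕ
∣ X ∣ = length (toList X)

data Outcome : Set where
  terminated : 𝔹 → Outcome
  inaction   : Outcome
  badInput   : Outcome

record State : Set where
  constructor st
  field
    auxs : ℕ → 𝔹
    outv : 𝔹
open State

update : (ℕ → 𝔹) → ℕ → 𝔹 → (ℕ → 𝔹)
update f k b j with j ≟ k
... | yes _ = b
... | no  _ = f j

data StepResult : Set where
  ok  : 𝔹 → State → StepResult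
  bad : StepResult

execBasic : ∀ {n} → Vec 𝔹 n → State → BasicInstr → StepResult
execBasic {n} w s (inGet k) with k <? n
... | yes k<n = ok (lookup w (fromℕ< k<n)) s
... | no  _   = bad
execBasic w s (auxGet k)   = ok (auxs s k) s
execBasic w s (auxSet k b) = ok b (st (update (auxs s) k b) (outv s))
execBasic w s (outSet b)   = ok b (st (auxs s) b)

-- `run fuel w s us` executes starting at the first instruction of the
-- remaining suffix `us` of the instruction sequence.  Since all jumps are
-- forward, every step strictly shortens the suffix, so fuel = length of
-- the sequence suffices (when fuel is exhausted the suffix is empty,
-- i.e. there is no instruction to proceed with: inaction).
run : ∀ {n} → ℕ → Vec 𝔹 n → State → List PrimInstr → Outcome
run zero    w s us = inaction
run (suc f) w s [] = inaction
run (suc f) w s (plain a ∷ us) with execBasic w s a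
... | bad      = badInput
... | ok _ s'  = run f w s' us
run (suc f) w s (ptest a ∷ us) with execBasic w s a
... | bad          = badInput
... | ok true  s'  = run f w s' us
... | ok false s'  = run f w s' (drop 1 us)
run (suc f) w s (ntest a ∷ us) with execBasic w s a
... | bad          = badInput
... | ok false s'  = run f w s' us
... | ok true  s'  = run f w s' (drop 1 us)
run (suc f) w s (jump zero ∷ us)    = inaction
run (suc f) w s (jump (suc l) ∷ us) = run f w s (drop l us)
run (suc f) w s (halt ∷ us)         = terminated (outv s)

initState : State
initState = st (λ _ → false) false

execute : ∀ {n} → IS → Vec 𝔹 n → Outcome
execute X w = run ∣ X ∣ w initState (toList X)

Computes : ∀ {n} → IS → (Vec 𝔹 n → 𝔹) → Set
Computes X f = ∀ w → execute X w ≡ terminated (f w)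

BoolFamily : Set
BoolFamily = (n : ℕ) → Vec 𝔹 n → 𝔹

-- Polynomials with natural-number coefficients (c₀ ∷ c₁ ∷ …)
evalPoly : List ℕ → ℕ → ℕ
evalPoly []       x = 0
evalPoly (c ∷ cs) x = c + x * evalPoly cs x

IsPolynomial : (ℕ → ℕ) → Set
IsPolynomial h = Σ (List ℕ) λ cs → ∀ n → h n ≡ evalPoly cs n

Monotonic : (ℕ → ℕ) → Set
Monotonic h = ∀ {m n} → m ≤ n → h m ≤ h n

P-IS : BoolFamily → Set
P-IS g = Σ (ℕ → ℕ) λ h → IsPolynomial h ×
         (∀ n → Σ IS λ X → Computes X (g n) × ∣ X ∣ ≤ h n)

NP-IS : BoolFamily → Set
NP-IS f = Σ (ℕ → ℕ) λ h → IsPolynomial h × Monotonic h ×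
          Σ BoolFamily λ g → P-IS g ×
          (∀ n (w : Vec 𝔹 n) →
             (f n w ≡ true) ⇔ (Σ (Vec 𝔹 (h n)) λ c → g (n + h n) (w ++ c) ≡ true))

double : ∀ {n} → Vec 𝔹 n → Vec 𝔹 (n + n)
double {zero}  []       = []
double {suc n} (b ∷ bs) rewrite Data.Nat.Properties.+-suc n n = b ∷ b ∷ double bs

_⋄_ : ∀ {n m} → Vec 𝔹 n → Vec 𝔹 m → Vec 𝔹 ((n + n) + (2 + m))
w ⋄ c = double w ++ (true ∷ false ∷ c)

-- Both directions replace the given verifier g by a polynomial-size decision list over input
-- bits whose leaves call g on re-wired inputs; a call is g's instruction sequence with its
-- input registers renamed.
--
-- From NP_IS: in w ⋄ c the bit pairs before position 2|w| are equal and the pair there is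
-- (T,F), so the first pair (T,F) reveals |w|; the new verifier rejects unless |c| = h(|w|)
-- and otherwise runs g on w c.
--
-- To NP_IS: a ⋄-certificate c of length m ≤ h(n) is padded to the fixed-length certificate
-- T f₀…f_{h(n)} p₁…p_{h(n)} with f_j = (j < m) and c a prefix of p. The new verifier finds m
-- as the first j with f_j = F and runs g on w ⋄ p₁…p_m; as a wiring can only copy bits, the
-- marker bits T and F of ⋄ are read from the leading T and from f_m.

module Submission where

open import Defs
open import Data.Bool using (Bool; true; false; not; _∧_; if_then_else_)
open import Data.Bool.Properties using (T-≡; if-not)
open import Data.Nat using (ℕ; zero; suc; _+_; _*_; _∸_; _≤_; _<_; _<?_; _<ᵇ_; ⌊_/2⌋; z≤n; s≤s; z<s; s<s; s≤s⁻¹)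
open import Data.Nat.Properties
  using ( _≟_; ≡-irrelevant; anyUpTo?; <-cmp; <-irrefl; ≮⇒≥; <⇒≢; <⇒≤; <⇒<ᵇ
        ; ≤-refl; ≤-reflexive; ≤-trans; <-trans; <-≤-trans; n<1+n; n≤1+n; m≤n⇒m≤1+n; m≤m+n; m≤n+m
        ; +-suc; +-comm; +-assoc; +-identityʳ; +-cancelˡ-≡; +-cancelˡ-<; m+n≮m; m+n∸m≡n; m+[n∸m]≡n
        ; +-mono-≤; +-monoˡ-≤; +-monoʳ-≤; +-mono-<; +-monoʳ-<; +-mono-<-≤
        ; *-zeroʳ; *-identityʳ; *-assoc; *-distribʳ-+; *-mono-≤; *-monoˡ-≤
        ; n≡⌊n+n/2⌋; ⌊n/2⌋-mono; ⌊n/2⌋≤n; module ≤-Reasoning )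
open import Data.Nat.Tactic.RingSolver using (solve-∀)
import Data.List as List
open List using (List; []; _∷_; length; map; drop)
open import Data.List.Properties using (++-identityʳ; length-++; length-map; drop-map; drop-drop)
open import Data.List.NonEmpty using (_∷_; toList)
open import Data.Vec using (Vec; []; _∷_; _++_; lookup)
open import Data.Fin using (Fin; zero; suc; toℕ; fromℕ<) renaming (_<_ to _<ᶠ_)
open import Data.Fin.Properties using (toℕ<n; toℕ-fromℕ<)
open import Data.Product using (Σ; _×_; _,_; proj₁; proj₂)
open import Function using (_∘_)
open import Function.Bundles using (_⇔_; mk⇔; Equivalence)
open import Relation.Nullary using (yes; no; ¬_; contradiction)
open import Relation.Binary.Definitions using (tri<; tri≈; tri>)
open import Relation.Binary.PropositionalEquality
  using (_≡_; _≢_; refl; sym; trans; cong; cong₂; subst; module ≡-Reasoning)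

private variable
  A : Set
  b : 𝔹
  k m n t N : ℕ
  f g : ℕ → ℕ
  s s′ : State
  w : Vec 𝔹 n

-- Bits of words

⌊1+t+t/2⌋≡t : ∀ t → ⌊ suc (t + t) /2⌋ ≡ t
⌊1+t+t/2⌋≡t zero    = refl
⌊1+t+t/2⌋≡t (suc t) rewrite +-suc t t = cong suc (⌊1+t+t/2⌋≡t t)

t<n+n⇒⌊t/2⌋<n : ∀ {t n} → t < n + n → ⌊ t /2⌋ < n
t<n+n⇒⌊t/2⌋<n {zero}        {suc n} _ = z<s
t<n+n⇒⌊t/2⌋<n {suc zero}    {suc n} _ = z<s
t<n+n⇒⌊t/2⌋<n {suc (suc t)} {suc n} (s<s t<n+n) rewrite +-suc n n = s<s (t<n+n⇒⌊t/2⌋<n (s≤s⁻¹ t<n+n))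

-- Out of range the junk value is false.
_‼_ : Vec 𝔹 n → ℕ → 𝔹
[]      ‼ _     = false
(b ∷ _) ‼ zero  = b
(_ ∷ w) ‼ suc t = w ‼ t

lookup-fromℕ< : (w : Vec 𝔹 n) (t<n : t < n) → lookup w (fromℕ< t<n) ≡ w ‼ t
lookup-fromℕ< {t = zero}  (b ∷ w) _         = refl
lookup-fromℕ< {t = suc t} (b ∷ w) (s<s t<n) = lookup-fromℕ< w t<n

‼-++ˡ : (u : Vec 𝔹 k) (v : Vec 𝔹 m) → t < k → (u ++ v) ‼ t ≡ u ‼ t
‼-++ˡ {t = zero}  (b ∷ u) v _         = refl
‼-++ˡ {t = suc t} (b ∷ u) v (s<s t<k) = ‼-++ˡ u v t<k

‼-++ʳ : (u : Vec 𝔹 k) (v : Vec 𝔹 m) (t : ℕ) → (u ++ v) ‼ (k + t) ≡ v ‼ t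
‼-++ʳ []      v t = refl
‼-++ʳ (b ∷ u) v t = ‼-++ʳ u v t

tabulateℕ : (k : ℕ) → (ℕ → A) → Vec A k
tabulateℕ zero    f = []
tabulateℕ (suc k) f = f 0 ∷ tabulateℕ k (λ t → f (suc t))

‼-tabulateℕ : (f : ℕ → 𝔹) → t < k → tabulateℕ k f ‼ t ≡ f t
‼-tabulateℕ {t = zero}  f z<s       = refl
‼-tabulateℕ {t = suc t} f (s<s t<k) = ‼-tabulateℕ (λ t → f (suc t)) t<k

tabulateℕ-‼ : (w : Vec 𝔹 n) → tabulateℕ n (w ‼_) ≡ w
tabulateℕ-‼ []      = refl
tabulateℕ-‼ (b ∷ w) = cong (b ∷_) (tabulateℕ-‼ w)

tabulateℕ-cong : {f g : ℕ → A} → (∀ {t} → t < k → f t ≡ g t) → tabulateℕ k f ≡ tabulateℕ k g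
tabulateℕ-cong {k = zero}  f≗g = refl
tabulateℕ-cong {k = suc k} f≗g = cong₂ _∷_ (f≗g z<s) (tabulateℕ-cong (λ t<k → f≗g (s<s t<k)))

tabulateℕ-+ : (f : ℕ → A) → tabulateℕ (k + m) f ≡ tabulateℕ k f ++ tabulateℕ m (λ t → f (k + t))
tabulateℕ-+ {k = zero}  f = refl
tabulateℕ-+ {k = suc k} f = cong (f 0 ∷_) (tabulateℕ-+ {k = k} (λ t → f (suc t)))

‼-double : (w : Vec 𝔹 n) (t : ℕ) → double w ‼ t ≡ w ‼ ⌊ t /2⌋
‼-double []                            t             = refl
‼-double {suc n} (b ∷ w) zero          rewrite +-suc n n = refl
‼-double {suc n} (b ∷ w) (suc zero)    rewrite +-suc n n = refl
‼-double {suc n} (b ∷ w) (suc (suc t)) rewrite +-suc n n = ‼-double w t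

‼-⋄-< : (w : Vec 𝔹 n) (c : Vec 𝔹 m) → t < n + n → (w ⋄ c) ‼ t ≡ w ‼ ⌊ t /2⌋
‼-⋄-< w c t<n+n = trans (‼-++ˡ (double w) _ t<n+n) (‼-double w _)

‼-⋄-+ : (w : Vec 𝔹 n) (c : Vec 𝔹 m) (t : ℕ) → (w ⋄ c) ‼ ((n + n) + t) ≡ (true ∷ false ∷ c) ‼ t
‼-⋄-+ w c = ‼-++ʳ (double w) _

‼-⋄-T : (w : Vec 𝔹 n) (c : Vec 𝔹 m) → (w ⋄ c) ‼ (n + n) ≡ true
‼-⋄-T {n} w c = trans (cong ((w ⋄ c) ‼_) (sym (+-identityʳ (n + n)))) (‼-⋄-+ w c 0)

‼-⋄-F : (w : Vec 𝔹 n) (c : Vec 𝔹 m) → (w ⋄ c) ‼ suc (n + n) ≡ false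
‼-⋄-F {n} w c = trans (cong ((w ⋄ c) ‼_) (+-comm 1 (n + n))) (‼-⋄-+ w c 1)

‼-⋄-even : (w : Vec 𝔹 n) (c : Vec 𝔹 m) → t < n → (w ⋄ c) ‼ (t + t) ≡ w ‼ t
‼-⋄-even w c t<n = trans (‼-⋄-< w c (+-mono-< t<n t<n)) (cong (w ‼_) (sym (n≡⌊n+n/2⌋ _)))

‼-⋄-odd : (w : Vec 𝔹 n) (c : Vec 𝔹 m) → t < n → (w ⋄ c) ‼ suc (t + t) ≡ w ‼ t
‼-⋄-odd {n} {t = t} w c t<n = trans (‼-⋄-< w c 1+t+t<n+n) (cong (w ‼_) (⌊1+t+t/2⌋≡t t))
  where
  1+t+t<n+n : suc (t + t) < n + n
  1+t+t<n+n = subst (_≤ n + n) (cong suc (+-suc t t)) (+-mono-≤ t<n t<n)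

-- Running instruction sequences

execBasic-inGet : ∀ {t} {w : Vec 𝔹 n} → t < n → execBasic w s (inGet t) ≡ ok (w ‼ t) s
execBasic-inGet {n} {s} {t} {w} t<n with t <? n
... | yes t<n′ = cong (λ b → ok b s) (lookup-fromℕ< w t<n′)
... | no  t≮n  = contradiction t<n t≮n

execBasic-inGet-≮ : ∀ {t} {w : Vec 𝔹 n} → ¬ t < n → execBasic w s (inGet t) ≡ bad
execBasic-inGet-≮ {n} {t = t} t≮n with t <? n
... | yes t<n = contradiction t<n t≮n
... | no  _   = refl

run-[] : ∀ f → run f w s [] ≢ terminated b
run-[] zero    ()
run-[] (suc f) ()

run-drop-++ : ∀ f f′ l (us vs : List PrimInstr) →
  (∀ us → run f w s us ≡ terminated b → run f′ w s (us List.++ vs) ≡ terminated b) →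
  run f w s (drop l us) ≡ terminated b → run f′ w s (drop l (us List.++ vs)) ≡ terminated b
run-drop-++ f f′ zero    us       vs run-++ halts = run-++ us halts
run-drop-++ f f′ (suc l) []       vs run-++ halts = contradiction halts (run-[] f)
run-drop-++ f f′ (suc l) (u ∷ us) vs run-++ halts = run-drop-++ f f′ l us vs run-++ halts

run-++ : ∀ {f f′} (us vs : List PrimInstr) → f ≤ f′ →
         run f w s us ≡ terminated b → run f′ w s (us List.++ vs) ≡ terminated b
run-++ {f = zero} _ _ _ ()
run-++ {f = suc f} [] _ _ ()
run-++ {w = w} {s} {f = suc f} {suc f′} (plain a ∷ us) vs (s≤s f≤f′) halts with execBasic w s a
... | bad     = contradiction halts λ ()
... | ok _ s′ = run-++ us vs f≤f′ halts
run-++ {w = w} {s} {f = suc f} {suc f′} (ptest a ∷ us) vs (s≤s f≤f′) halts with execBasic w s a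
... | bad         = contradiction halts λ ()
... | ok true  s′ = run-++ us vs f≤f′ halts
... | ok false s′ = run-drop-++ {w = w} {s′} f f′ 1 us vs (λ us → run-++ us vs f≤f′) halts
run-++ {w = w} {s} {f = suc f} {suc f′} (ntest a ∷ us) vs (s≤s f≤f′) halts with execBasic w s a
... | bad         = contradiction halts λ ()
... | ok false s′ = run-++ us vs f≤f′ halts
... | ok true  s′ = run-drop-++ {w = w} {s′} f f′ 1 us vs (λ us → run-++ us vs f≤f′) halts
run-++ {f = suc f} (jump zero ∷ us) _ _ ()
run-++ {w = w} {s} {f = suc f} {suc f′} (jump (suc l) ∷ us) vs (s≤s f≤f′) halts =
  run-drop-++ {w = w} {s} f f′ l us vs (λ us → run-++ us vs f≤f′) halts
run-++ {f = suc f} {suc f′} (halt ∷ us) vs _ halts = halts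

run-mono : ∀ {f f′} (us : List PrimInstr) → f ≤ f′ →
           run f w s us ≡ terminated b → run f′ w s us ≡ terminated b
run-mono {w = w} {s} {f′ = f′} us f≤f′ halts =
  subst (λ us → run f′ w s us ≡ terminated _) (++-identityʳ us) (run-++ us [] f≤f′ halts)

-- Wirings and renaming of input registers

record Wiring (k n : ℕ) : Set where
  constructor wiring
  field
    source  : ℕ → ℕ
    source< : ∀ {t} → t < k → source t < n
open Wiring public

wire : Wiring k n → Vec 𝔹 n → Vec 𝔹 k
wire {k} ρ v = tabulateℕ k (λ t → v ‼ source ρ t)

wire-ext : ∀ (ρ : Wiring k n) v {u} → (∀ {t} → t < k → v ‼ source ρ t ≡ u ‼ t) → wire ρ v ≡ u
wire-ext ρ v {u} eq = trans (tabulateℕ-cong eq) (tabulateℕ-‼ u)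

_⊕_ : Wiring k n → Wiring m n → Wiring (k + m) n
source (_⊕_ {k} ρ τ) t with t <? k
... | yes _ = source ρ t
... | no  _ = source τ (t ∸ k)
source< (_⊕_ {k} ρ τ) {t} t<k+m with t <? k
... | yes t<k = source< ρ t<k
... | no  t≮k = source< τ (+-cancelˡ-< k _ _ (subst (_< _) (sym (m+[n∸m]≡n (≮⇒≥ t≮k))) t<k+m))

source-⊕ˡ : ∀ (ρ : Wiring k n) (τ : Wiring m n) {t} → t < k → source (ρ ⊕ τ) t ≡ source ρ t
source-⊕ˡ {k} ρ τ {t} t<k with t <? k
... | yes _   = refl
... | no  t≮k = contradiction t<k t≮k

source-⊕ʳ : ∀ (ρ : Wiring k n) (τ : Wiring m n) t → source (ρ ⊕ τ) (k + t) ≡ source τ t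
source-⊕ʳ {k} ρ τ t with k + t <? k
... | yes k+t<k = contradiction k+t<k (m+n≮m k t)
... | no  _     = cong (source τ) (m+n∸m≡n k t)

wire-⊕ : ∀ (ρ : Wiring k n) (τ : Wiring m n) v → wire (ρ ⊕ τ) v ≡ wire ρ v ++ wire τ v
wire-⊕ {k} {m = m} ρ τ v = trans (tabulateℕ-+ {k = k} {m} _)
  (cong₂ _++_ (tabulateℕ-cong λ t<k → cong (v ‼_) (source-⊕ˡ ρ τ t<k))
              (tabulateℕ-cong λ {t} _ → cong (v ‼_) (source-⊕ʳ ρ τ t)))

offset : ∀ o → o + k ≤ n → Wiring k n
offset o o+k≤n = wiring (o +_) (λ t<k → <-≤-trans (+-monoʳ-< o t<k) o+k≤n)

bit : ∀ p → p < n → Wiring 1 n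
bit p p<n = wiring (λ _ → p) (λ _ → p<n)

-- Reads beyond the arity k are sent beyond n as well, so relabelling commutes
-- exactly with execution, failures included.
relabelBasic : Wiring k n → BasicInstr → BasicInstr
relabelBasic {k} {n} ρ (inGet t) with t <? k
... | yes _ = inGet (source ρ t)
... | no  _ = inGet n
relabelBasic ρ a = a

relabel : Wiring k n → PrimInstr → PrimInstr
relabel ρ (plain a) = plain (relabelBasic ρ a)
relabel ρ (ptest a) = ptest (relabelBasic ρ a)
relabel ρ (ntest a) = ntest (relabelBasic ρ a)
relabel ρ (jump l)  = jump l
relabel ρ halt      = halt

execBasic-relabel : ∀ (ρ : Wiring k n) v a → execBasic v s (relabelBasic ρ a) ≡ execBasic (wire ρ v) s a
execBasic-relabel {k} {n} {s} ρ v (inGet t) with t <? k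
... | yes t<k = trans (execBasic-inGet (source< ρ t<k))
                      (cong (λ b → ok b s) (sym (trans (lookup-fromℕ< (wire ρ v) t<k) (‼-tabulateℕ _ t<k))))
... | no  _   = execBasic-inGet-≮ (<-irrefl refl)
execBasic-relabel ρ v (auxGet _)   = refl
execBasic-relabel ρ v (auxSet _ _) = refl
execBasic-relabel ρ v (outSet _)   = refl

run-relabel : ∀ (ρ : Wiring k n) v f us → run f v s (map (relabel ρ) us) ≡ run f (wire ρ v) s us
run-relabel ρ v zero    us = refl
run-relabel ρ v (suc f) [] = refl
run-relabel {s = s} ρ v (suc f) (plain a ∷ us) rewrite execBasic-relabel {s = s} ρ v a
  with execBasic (wire ρ v) s a
... | bad     = refl
... | ok _ s′ = run-relabel ρ v f us
run-relabel {s = s} ρ v (suc f) (ptest a ∷ us) rewrite execBasic-relabel {s = s} ρ v a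
  with execBasic (wire ρ v) s a
... | bad         = refl
... | ok true  s′ = run-relabel ρ v f us
... | ok false s′ rewrite drop-map {f = relabel ρ} 1 us = run-relabel ρ v f (drop 1 us)
run-relabel {s = s} ρ v (suc f) (ntest a ∷ us) rewrite execBasic-relabel {s = s} ρ v a
  with execBasic (wire ρ v) s a
... | bad         = refl
... | ok false s′ = run-relabel ρ v f us
... | ok true  s′ rewrite drop-map {f = relabel ρ} 1 us = run-relabel ρ v f (drop 1 us)
run-relabel ρ v (suc f) (jump zero ∷ us) = refl
run-relabel ρ v (suc f) (jump (suc l) ∷ us) rewrite drop-map {f = relabel ρ} l us = run-relabel ρ v f (drop l us)
run-relabel ρ v (suc f) (halt ∷ us) = refl

-- Polynomials

_+ₚ_ : List ℕ → List ℕ → List ℕ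
[]       +ₚ ds       = ds
(c ∷ cs) +ₚ []       = c ∷ cs
(c ∷ cs) +ₚ (d ∷ ds) = c + d ∷ cs +ₚ ds

evalPoly-+ₚ : ∀ cs ds x → evalPoly (cs +ₚ ds) x ≡ evalPoly cs x + evalPoly ds x
evalPoly-+ₚ []       ds       x = refl
evalPoly-+ₚ (c ∷ cs) []       x = sym (+-identityʳ _)
evalPoly-+ₚ (c ∷ cs) (d ∷ ds) x rewrite evalPoly-+ₚ cs ds x = regroup c d x (evalPoly cs x) (evalPoly ds x)
  where
  regroup : ∀ c d x a b → c + d + x * (a + b) ≡ c + x * a + (d + x * b)
  regroup = solve-∀

poly-≗ : (∀ n → f n ≡ g n) → IsPolynomial f → IsPolynomial g
poly-≗ f≗g (cs , f≡cs) = cs , λ n → trans (sym (f≗g n)) (f≡cs n)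

poly-const : ∀ c → IsPolynomial (λ _ → c)
poly-const c = c ∷ [] , λ n → sym (trans (cong (c +_) (*-zeroʳ n)) (+-identityʳ c))

poly-id : IsPolynomial (λ n → n)
poly-id = 0 ∷ 1 ∷ [] , λ n → sym (trans (cong (λ m → n * suc m) (*-zeroʳ n)) (*-identityʳ n))

poly-+ : IsPolynomial f → IsPolynomial g → IsPolynomial (λ n → f n + g n)
poly-+ (cs , f≡) (ds , g≡) = cs +ₚ ds , λ n → trans (cong₂ _+_ (f≡ n) (g≡ n)) (sym (evalPoly-+ₚ cs ds n))

poly-x* : IsPolynomial f → IsPolynomial (λ n → n * f n)
poly-x* (cs , f≡) = 0 ∷ cs , λ n → cong (n *_) (f≡ n)

poly-scale : ∀ c → IsPolynomial f → IsPolynomial (λ n → c * f n)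
poly-scale zero    F = poly-const 0
poly-scale (suc c) F = poly-+ F (poly-scale c F)

poly-evalPoly-* : ∀ cs → IsPolynomial g → IsPolynomial (λ n → evalPoly cs n * g n)
poly-evalPoly-* []       G = poly-const 0
poly-evalPoly-* {g} (c ∷ cs) G =
  poly-≗ (λ n → sym (trans (*-distribʳ-+ (g n) c (n * evalPoly cs n)) (cong (c * g n +_) (*-assoc n _ _))))
         (poly-+ (poly-scale c G) (poly-x* (poly-evalPoly-* cs G)))

poly-* : IsPolynomial f → IsPolynomial g → IsPolynomial (λ n → f n * g n)
poly-* {g = g} (cs , f≡) G = poly-≗ (λ n → cong (_* g n) (sym (f≡ n))) (poly-evalPoly-* cs G)

poly-∘ : IsPolynomial f → IsPolynomial g → IsPolynomial (λ n → f (g n))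
poly-∘ {g = g} (cs , f≡) G = poly-≗ (λ n → sym (f≡ (g n))) (poly-evalPoly-∘ cs)
  where
  poly-evalPoly-∘ : ∀ cs → IsPolynomial (λ n → evalPoly cs (g n))
  poly-evalPoly-∘ []       = poly-const 0
  poly-evalPoly-∘ (c ∷ cs) = poly-+ (poly-const c) (poly-* G (poly-evalPoly-∘ cs))

evalPoly-mono : ∀ cs → Monotonic (evalPoly cs)
evalPoly-mono []       m≤n = z≤n
evalPoly-mono (c ∷ cs) m≤n = +-monoʳ-≤ c (*-mono-≤ m≤n (evalPoly-mono cs m≤n))

poly-mono : IsPolynomial f → Monotonic f
poly-mono {f} (cs , f≡) {m} {n} m≤n rewrite f≡ m | f≡ n = evalPoly-mono cs m≤n

-- Decision lists calling a verifier

record Literal (n : ℕ) : Set where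
  constructor literal
  field
    position  : ℕ
    position< : position < n
    value     : 𝔹

holds : Vec 𝔹 n → Literal n → Bool
holds v (literal a _ b) = if b then v ‼ a else not (v ‼ a)

holdsAll : Vec 𝔹 n → List (Literal n) → Bool
holdsAll v []       = true
holdsAll v (ℓ ∷ ls) = holds v ℓ ∧ holdsAll v ls

skipIfHolds : Literal n → PrimInstr
skipIfHolds (literal a _ true)  = ntest (inGet a)
skipIfHolds (literal a _ false) = ptest (inGet a)

run-ptest : ∀ {n f a r us} {w : Vec 𝔹 n} → execBasic w s a ≡ ok r s′ →
            run (suc f) w s (ptest a ∷ us) ≡ (if r then run f w s′ us else run f w s′ (drop 1 us))
run-ptest {r = true}  eq rewrite eq = refl
run-ptest {r = false} eq rewrite eq = refl

run-ntest : ∀ {n f a r us} {w : Vec 𝔹 n} → execBasic w s a ≡ ok r s′ →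
            run (suc f) w s (ntest a ∷ us) ≡ (if r then run f w s′ (drop 1 us) else run f w s′ us)
run-ntest {r = true}  eq rewrite eq = refl
run-ntest {r = false} eq rewrite eq = refl

run-skipIfHolds : ∀ {f us} {v : Vec 𝔹 n} (ℓ : Literal n) →
  run (suc f) v s (skipIfHolds ℓ ∷ us) ≡ (if holds v ℓ then run f v s (drop 1 us) else run f v s us)
run-skipIfHolds {v = v} (literal a a<n true) = run-ntest (execBasic-inGet a<n)
run-skipIfHolds {v = v} (literal a a<n false) = trans (run-ptest (execBasic-inGet a<n)) (sym (if-not (v ‼ a)))

drop-length-++ : (xs ys : List A) → drop (length xs) (xs List.++ ys) ≡ ys
drop-length-++ []       ys = refl
drop-length-++ (x ∷ xs) ys = drop-length-++ xs ys

Halts : Vec 𝔹 n → List PrimInstr → 𝔹 → Set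
Halts v us b = ∀ {f} → length us ≤ f → run f v initState us ≡ terminated b

guardCode : List (Literal n) → ℕ → List PrimInstr
guardCode []       l = []
guardCode (ℓ ∷ ls) l = skipIfHolds ℓ ∷ jump (suc (length (guardCode ls l) + l)) ∷ guardCode ls l

run-guardCode : ∀ {v : Vec 𝔹 n} ls (L Q : List PrimInstr) {bL bQ} → Halts v L bL → Halts v Q bQ →
  Halts v (guardCode ls (length L) List.++ L List.++ Q) (if holdsAll v ls then bL else bQ)
run-guardCode [] L Q L⇓ Q⇓ f≥ =
  run-++ {f = length L} L Q (≤-trans (m≤m+n _ _) (≤-trans (≤-reflexive (sym (length-++ L))) f≥)) (L⇓ ≤-refl)
run-guardCode {v = v} (ℓ ∷ ls) L Q {bL} {bQ} L⇓ Q⇓ {suc (suc f)} (s≤s (s≤s f≥)) =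
  trans (run-skipIfHolds ℓ) (branch (holds v ℓ))
  where
  G    = guardCode ls (length L)
  rest = G List.++ L List.++ Q
  skipped : drop (length G + length L) rest ≡ Q
  skipped = trans (sym (drop-drop (length G) (length L) rest))
                  (trans (cong (drop (length L)) (drop-length-++ G (L List.++ Q))) (drop-length-++ L Q))
  Q≤rest : length Q ≤ length rest
  Q≤rest = begin
    length Q                         ≤⟨ m≤n+m _ (length L) ⟩
    length L + length Q              ≤⟨ m≤n+m _ (length G) ⟩
    length G + (length L + length Q) ≡⟨ cong (length G +_) (sym (length-++ L)) ⟩
    length G + length (L List.++ Q)       ≡⟨ sym (length-++ G) ⟩
    length rest                      ∎
    where open ≤-Reasoning
  branch : ∀ b → (if b then run (suc f) v initState rest
                           else run (suc f) v initState (jump (suc (length G + length L)) ∷ rest))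
                 ≡ terminated (if b ∧ holdsAll v ls then bL else bQ)
  branch true  = run-guardCode ls L Q L⇓ Q⇓ (≤-trans f≥ (n≤1+n f))
  branch false = trans (cong (run f v initState) skipped) (Q⇓ (≤-trans Q≤rest f≥))

module DecisionPrograms {g : BoolFamily} (g∈P : P-IS g) where

  bound : ℕ → ℕ
  bound = proj₁ g∈P

  private
    X : ℕ → IS
    X k = proj₁ (proj₂ (proj₂ g∈P) k)

    X-computes : ∀ k → Computes (X k) (g k)
    X-computes k = proj₁ (proj₂ (proj₂ (proj₂ g∈P) k))

  infix 1 ifAll_then_else_
  data Prog (n : ℕ) : Set where
    reject           : Prog n
    call             : Wiring k n → Prog n
    ifAll_then_else_ : List (Literal n) → Prog n → Prog n → Prog n

  eval : Prog n → Vec 𝔹 n → 𝔹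
  eval reject                     v = false
  eval (call {k} ρ)               v = g k (wire ρ v)
  eval (ifAll ls then L else Q) v = if holdsAll v ls then eval L v else eval Q v

  compile : Prog n → List PrimInstr
  compile reject                     = halt ∷ []
  compile (call {k} ρ)               = map (relabel ρ) (toList (X k))
  compile (ifAll ls then L else Q) = guardCode ls (length (compile L)) List.++ compile L List.++ compile Q

  size : Prog n → ℕ
  size p = length (compile p)

  size-ifAll : ∀ ls (L Q : Prog n) →
    size (ifAll ls then L else Q) ≡ length (guardCode ls (size L)) + size L + size Q
  size-ifAll ls L Q = begin
    length (G List.++ compile L List.++ compile Q)  ≡⟨ length-++ G ⟩
    length G + length (compile L List.++ compile Q) ≡⟨ cong (length G +_) (length-++ (compile L)) ⟩
    length G + (size L + size Q)                    ≡⟨ sym (+-assoc (length G) _ _) ⟩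
    length G + size L + size Q                      ∎
    where
    open ≡-Reasoning
    G = guardCode ls (size L)

  size-call : ∀ {K} (ρ : Wiring k n) → k ≤ K → size (call ρ) ≤ bound K
  size-call {k} ρ k≤K = begin
    length (map (relabel ρ) (toList (X k))) ≡⟨ length-map (relabel ρ) (toList (X k)) ⟩
    ∣ X k ∣                                 ≤⟨ proj₂ (proj₂ (proj₂ (proj₂ g∈P) k)) ⟩
    bound k                                 ≤⟨ poly-mono (proj₁ (proj₂ g∈P)) k≤K ⟩
    bound _                                 ∎
    where open ≤-Reasoning

  compile-correct : (p : Prog n) (v : Vec 𝔹 n) → Halts v (compile p) (eval p v)
  compile-correct reject v {suc f} _ = refl
  compile-correct (call {k} ρ) v {f} f≥ =
    trans (run-relabel ρ v f (toList (X k)))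
          (run-mono (toList (X k)) (subst (_≤ f) (length-map (relabel ρ) (toList (X k))) f≥)
                    (X-computes k (wire ρ v)))
  compile-correct (ifAll ls then L else Q) v =
    run-guardCode ls (compile L) (compile Q) (compile-correct L v) (compile-correct Q v)

  -- The leading #1 is a no-op making the instruction sequence non-empty.
  toIS : Prog n → IS
  toIS p = jump 1 ∷ compile p

  toIS-computes : (p : Prog n) → Computes (toIS p) (eval p)
  toIS-computes p v = compile-correct p v ≤-refl

  P-IS-eval : (prog : ∀ N → Prog N) {B : ℕ → ℕ} → IsPolynomial B → (∀ N → size (prog N) ≤ B N) →
              P-IS (λ N → eval (prog N))
  P-IS-eval prog B-poly size≤B =
    _ , poly-+ (poly-const 1) B-poly , λ N → toIS (prog N) , toIS-computes (prog N) , s≤s (size≤B N)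

  infix 2 _⇒_
  record Branch (n : ℕ) : Set where
    constructor _⇒_
    field
      guard : List (Literal n)
      body  : Prog n
  open Branch public

  cascade : (Fin k → Branch n) → Prog n
  cascade {zero}  bs = reject
  cascade {suc k} bs = ifAll guard (bs zero) then body (bs zero) else cascade (bs ∘ suc)

  eval-cascade-first : ∀ {v : Vec 𝔹 n} (bs : Fin k → Branch n) i →
    (∀ j → j <ᶠ i → holdsAll v (guard (bs j)) ≡ false) → holdsAll v (guard (bs i)) ≡ true →
    eval (cascade bs) v ≡ eval (body (bs i)) v
  eval-cascade-first bs zero    _      holds rewrite holds = refl
  eval-cascade-first bs (suc i) before holds rewrite before zero (s≤s z≤n) =
    eval-cascade-first (bs ∘ suc) i (λ j j<i → before (suc j) (s≤s j<i)) holds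

  eval-cascade-true : ∀ {v : Vec 𝔹 n} (bs : Fin k → Branch n) → eval (cascade bs) v ≡ true →
    Σ (Fin k) λ i → holdsAll v (guard (bs i)) ≡ true × eval (body (bs i)) v ≡ true
  eval-cascade-true {k = suc k} {v = v} bs accepts with holdsAll v (guard (bs zero)) in holds
  ... | true  = zero , holds , accepts
  ... | false with eval-cascade-true (bs ∘ suc) accepts
  ...   | i , holdsᵢ , acceptsᵢ = suc i , holdsᵢ , acceptsᵢ

  cost : Branch n → ℕ
  cost (ls ⇒ P) = length (guardCode ls (size P)) + size P

  size-cascade : ∀ {B} (bs : Fin k → Branch n) → (∀ i → cost (bs i) ≤ B) → size (cascade bs) ≤ k * B + 1
  size-cascade {zero}  bs cost≤B = ≤-refl
  size-cascade {suc k} {B = B} bs cost≤B = begin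
    size (cascade bs)
      ≡⟨ size-ifAll (guard (bs zero)) (body (bs zero)) (cascade (bs ∘ suc)) ⟩
    cost (bs zero) + size (cascade (bs ∘ suc))
      ≤⟨ +-mono-≤ (cost≤B zero) (size-cascade (bs ∘ suc) (cost≤B ∘ suc)) ⟩
    B + (k * B + 1)
      ≡⟨ sym (+-assoc B _ 1) ⟩
    suc k * B + 1
      ∎
    where open ≤-Reasoning

module _ (v : Vec 𝔹 n) where
  open Literal

  single-holds : ∀ ℓ → v ‼ position ℓ ≡ value ℓ → holdsAll v (ℓ ∷ []) ≡ true
  single-holds (literal p _ true)  v‼p≡b rewrite v‼p≡b = refl
  single-holds (literal p _ false) v‼p≡b rewrite v‼p≡b = refl

  single-fails : ∀ ℓ → v ‼ position ℓ ≡ not (value ℓ) → holdsAll v (ℓ ∷ []) ≡ false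
  single-fails (literal p _ true)  v‼p≡¬b rewrite v‼p≡¬b = refl
  single-fails (literal p _ false) v‼p≡¬b rewrite v‼p≡¬b = refl

  single-holds⁻¹ : ∀ ℓ → holdsAll v (ℓ ∷ []) ≡ true → v ‼ position ℓ ≡ value ℓ
  single-holds⁻¹ (literal p _ b) holds with v ‼ p | b
  ... | true  | true  = refl
  ... | false | false = refl
  ... | true  | false = contradiction holds λ ()
  ... | false | true  = contradiction holds λ ()

-- From fixed-length certificates to ⋄-certificates

Accepts⋄ : ∀ {n} → (ℕ → ℕ) → BoolFamily → Vec 𝔹 n → Set
Accepts⋄ {n} h g w = Σ ℕ λ m → Σ (Vec 𝔹 m) λ c → m ≤ h n × g ((n + n) + (2 + m)) (w ⋄ c) ≡ true

NP-IS⋄ : BoolFamily → Set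
NP-IS⋄ f = Σ (ℕ → ℕ) λ h → IsPolynomial h × Σ BoolFamily λ g → P-IS g ×
           (∀ n (w : Vec 𝔹 n) → (f n w ≡ true) ⇔ Accepts⋄ h g w)

i<⌊n/2⌋⇒1+i+i<n : ∀ {i} → i < ⌊ n /2⌋ → suc (i + i) < n
i<⌊n/2⌋⇒1+i+i<n {suc (suc n)} {zero}  _         = s<s z<s
i<⌊n/2⌋⇒1+i+i<n {suc (suc n)} {suc i} (s<s i<) rewrite +-suc i i = s<s (s<s (i<⌊n/2⌋⇒1+i+i<n i<))

n<⌊n+n+[2+m]/2⌋ : ∀ n m → n < ⌊ (n + n) + (2 + m) /2⌋
n<⌊n+n+[2+m]/2⌋ n m = ≤-trans (≤-reflexive (cong suc (n≡⌊n+n/2⌋ n))) (⌊n/2⌋-mono 2+2n≤)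
  where
  2+2n≤ : 2 + (n + n) ≤ (n + n) + (2 + m)
  2+2n≤ = ≤-trans (≤-reflexive (+-comm 2 (n + n))) (+-monoʳ-≤ (n + n) (m≤m+n 2 m))

evens : n + n ≤ N → Wiring n N
evens n+n≤N = wiring (λ t → t + t) (λ t<n → <-≤-trans (+-mono-< t<n t<n) n+n≤N)

wire-evens-⋄ : ∀ (w : Vec 𝔹 n) (c : Vec 𝔹 m) p → wire (evens p) (w ⋄ c) ≡ w
wire-evens-⋄ w c p = wire-ext (evens p) (w ⋄ c) (‼-⋄-even w c)

wire-offset-⋄ : ∀ (w : Vec 𝔹 n) (c : Vec 𝔹 m) p → wire (offset ((n + n) + 2) p) (w ⋄ c) ≡ c
wire-offset-⋄ {n} w c p = wire-ext (offset _ p) (w ⋄ c) λ {t} _ →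
  trans (cong ((w ⋄ c) ‼_) (+-assoc (n + n) 2 t)) (‼-⋄-+ w c (2 + t))

module DiamondVerifier (H : ℕ → ℕ) (H-mono : Monotonic H) {g : BoolFamily} (g∈P : P-IS g) where
  open DecisionPrograms g∈P

  module _ {N} i (e : N ≡ (i + i) + (2 + H i)) where
    word-fits : i + i ≤ N
    word-fits = subst (_ ≤_) (sym e) (m≤m+n (i + i) _)

    certificate-fits : ((i + i) + 2) + H i ≤ N
    certificate-fits = ≤-reflexive (trans (+-assoc (i + i) 2 _) (sym e))

    unpad : Wiring (i + H i) N
    unpad = evens word-fits ⊕ offset ((i + i) + 2) certificate-fits

  candidate : ∀ N i → Prog N
  candidate N i with N ≟ (i + i) + (2 + H i)
  ... | yes e = call (unpad i e)
  ... | no  _ = reject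

  pairGuard : ∀ i → suc (i + i) < N → List (Literal N)
  pairGuard i p = literal (i + i) (<-trans (n<1+n _) p) true ∷ literal (suc (i + i)) p false ∷ []

  pairAt : (i : Fin ⌊ N /2⌋) → List (Literal N)
  pairAt i = pairGuard (toℕ i) (i<⌊n/2⌋⇒1+i+i<n (toℕ<n i))

  scan : ∀ N → Prog N
  scan N = cascade λ i → pairAt i ⇒ candidate N (toℕ i)

  wire-unpad : (w : Vec 𝔹 n) (c : Vec 𝔹 (H n)) → ∀ e → wire (unpad n e) (w ⋄ c) ≡ w ++ c
  wire-unpad {n} w c e =
    trans (wire-⊕ {k = n} {m = H n} _ _ (w ⋄ c))
          (cong₂ _++_ (wire-evens-⋄ w c (word-fits n e)) (wire-offset-⋄ w c (certificate-fits n e)))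

  eval-candidate : (w : Vec 𝔹 n) (c : Vec 𝔹 (H n)) → eval (candidate _ n) (w ⋄ c) ≡ g (n + H n) (w ++ c)
  eval-candidate {n} w c with (n + n) + (2 + H n) ≟ (n + n) + (2 + H n)
  ... | yes e = cong (g (n + H n)) (wire-unpad w c e)
  ... | no ≢ = contradiction refl ≢

  candidate-accepts : (w : Vec 𝔹 n) (c : Vec 𝔹 m) → eval (candidate _ n) (w ⋄ c) ≡ true → m ≡ H n
  candidate-accepts {n} {m} w c accepts with (n + n) + (2 + m) ≟ (n + n) + (2 + H n)
  ... | yes e = +-cancelˡ-≡ 2 _ _ (+-cancelˡ-≡ (n + n) _ _ e)
  ... | no  _ = contradiction accepts λ ()

  pairGuard-fails : (w : Vec 𝔹 n) (c : Vec 𝔹 m) → ∀ {i} p → i < n → holdsAll (w ⋄ c) (pairGuard i p) ≡ false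
  pairGuard-fails w c {i} p i<n rewrite ‼-⋄-even w c i<n | ‼-⋄-odd w c i<n with w ‼ i
  ... | true  = refl
  ... | false = refl

  pairGuard-holds : (w : Vec 𝔹 n) (c : Vec 𝔹 m) → ∀ {i} p → i ≡ n → holdsAll (w ⋄ c) (pairGuard i p) ≡ true
  pairGuard-holds w c p refl rewrite ‼-⋄-T w c | ‼-⋄-F w c = refl

  eval-scan-⋄ : (w : Vec 𝔹 n) (c : Vec 𝔹 m) → eval (scan _) (w ⋄ c) ≡ eval (candidate _ n) (w ⋄ c)
  eval-scan-⋄ {n} {m} w c =
    trans (eval-cascade-first _ i before (pairGuard-holds w c (i<⌊n/2⌋⇒1+i+i<n (toℕ<n i)) i≡n))
          (cong (λ i → eval (candidate _ i) (w ⋄ c)) i≡n)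
    where
    n< = n<⌊n+n+[2+m]/2⌋ n m
    i = fromℕ< n<
    i≡n = toℕ-fromℕ< n<
    before : ∀ j → j <ᶠ i → holdsAll (w ⋄ c) (pairAt j) ≡ false
    before j j<i = pairGuard-fails w c (i<⌊n/2⌋⇒1+i+i<n (toℕ<n j)) (subst (toℕ j <_) i≡n j<i)

  size-candidate : ∀ N i → i ≤ N → size (candidate N i) ≤ suc (bound (N + H N))
  size-candidate N i i≤N with N ≟ (i + i) + (2 + H i)
  ... | yes e = m≤n⇒m≤1+n (size-call (unpad i e) (+-mono-≤ i≤N (H-mono i≤N)))
  ... | no  _ = s≤s z≤n

  size-scan : ∀ N → size (scan N) ≤ N * (5 + bound (N + H N)) + 1
  size-scan N = ≤-trans (size-cascade _ λ i → s≤s (s≤s (s≤s (s≤s (size-candidate N (toℕ i) (i≤N i))))))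
                        (+-monoˡ-≤ 1 (*-monoˡ-≤ _ (⌊n/2⌋≤n N)))
    where
    i≤N : (i : Fin ⌊ N /2⌋) → toℕ i ≤ N
    i≤N i = ≤-trans (<⇒≤ (toℕ<n i)) (⌊n/2⌋≤n N)

NP-IS⇒NP-IS⋄ : ∀ f → NP-IS f → NP-IS⋄ f
NP-IS⇒NP-IS⋄ f (H , H-poly , H-mono , g , g∈P , f⇔g) =
  H , H-poly , (λ N → eval (scan N)) , P-IS-eval scan size-poly size-scan , λ n w → mk⇔ (to w) (from w)
  where
  open DecisionPrograms g∈P
  open DiamondVerifier H H-mono g∈P

  size-poly : IsPolynomial (λ N → N * (5 + bound (N + H N)) + 1)
  size-poly = poly-+ (poly-* poly-id (poly-+ (poly-const 5) (poly-∘ (proj₁ (proj₂ g∈P)) (poly-+ poly-id H-poly))))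
                     (poly-const 1)

  to : (w : Vec 𝔹 n) → f n w ≡ true → Accepts⋄ H (λ N → eval (scan N)) w
  to {n} w fw with Equivalence.to (f⇔g n w) fw
  ... | c , gwc = H n , c , ≤-refl , trans (eval-scan-⋄ w c) (trans (eval-candidate w c) gwc)

  from : (w : Vec 𝔹 n) → Accepts⋄ H (λ N → eval (scan N)) w → f n w ≡ true
  from {n} w (m , c , _ , accepts) with candidate-accepts w c (trans (sym (eval-scan-⋄ w c)) accepts)
  ... | refl = Equivalence.from (f⇔g n w)
                 (c , trans (sym (eval-candidate w c)) (trans (sym (eval-scan-⋄ w c)) accepts))

-- From ⋄-certificates to fixed-length certificates

halves : ∀ n → n ≤ N → Wiring (n + n) N
halves n n≤N = wiring ⌊_/2⌋ (λ t<n+n → <-≤-trans (t<n+n⇒⌊t/2⌋<n {n = n} t<n+n) n≤N)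

wire-halves : ∀ (w : Vec 𝔹 n) (c : Vec 𝔹 m) p → wire (halves n p) (w ++ c) ≡ double w
wire-halves {n} w c p = wire-ext (halves n p) (w ++ c) λ {t} t<n+n →
  trans (‼-++ˡ w c (t<n+n⇒⌊t/2⌋<n {n = n} t<n+n)) (sym (‼-double w t))

<⇒<ᵇ≡true : m < n → (m <ᵇ n) ≡ true
<⇒<ᵇ≡true m<n = Equivalence.to T-≡ (<⇒<ᵇ m<n)

n<ᵇn≡false : ∀ n → (n <ᵇ n) ≡ false
n<ᵇn≡false zero    = refl
n<ᵇn≡false (suc n) = n<ᵇn≡false n

n+f[n]-injective : ∀ {f : ℕ → ℕ} → Monotonic f → ∀ {m n} → m + f m ≡ n + f n → m ≡ n
n+f[n]-injective {f} f-mono {m} {n} e with <-cmp m n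
... | tri< m<n _ _ = contradiction e (<⇒≢ (+-mono-<-≤ m<n (f-mono (<⇒≤ m<n))))
... | tri≈ _ m≡n _ = m≡n
... | tri> _ _ n<m = contradiction (sym e) (<⇒≢ (+-mono-<-≤ n<m (f-mono (<⇒≤ n<m))))

module FixedLengthVerifier (h : ℕ → ℕ) (h-mono : Monotonic h) {g : BoolFamily} (g∈P : P-IS g) where
  open DecisionPrograms g∈P

  certLength : ℕ → ℕ
  certLength n = suc (suc (h n) + h n)

  certLength-mono : Monotonic certLength
  certLength-mono n≤n′ = s≤s (+-mono-≤ (s≤s (h-mono n≤n′)) (h-mono n≤n′))

  module _ (n : ℕ) where
    certBit : ∀ {x} → x < certLength n → (b : 𝔹) → Literal (n + certLength n)
    certBit {x} x< = literal (n + x) (+-monoʳ-< n x<)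

    flag< : ∀ {j} → j ≤ h n → suc j < certLength n
    flag< j≤ = s<s (s≤s (≤-trans j≤ (m≤m+n (h n) (h n))))

    payload : ∀ j → j ≤ h n → Wiring j (n + certLength n)
    payload j j≤ = offset (n + suc (suc (h n)))
      (≤-trans (≤-reflexive (+-assoc n _ j)) (+-monoʳ-≤ n (s≤s (s≤s (+-monoʳ-≤ (h n) j≤)))))

    word : Wiring (n + n) (n + certLength n)
    word = halves n (m≤m+n n _)

    marker : Wiring 1 (n + certLength n)
    marker = bit (n + 0) (+-monoʳ-< n z<s)

    flag : ∀ j → j ≤ h n → Wiring 1 (n + certLength n)
    flag j j≤ = bit (n + suc j) (+-monoʳ-< n (flag< j≤))

    restore : ∀ j → j ≤ h n → Wiring ((n + n) + (2 + j)) (n + certLength n)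
    restore j j≤ = word ⊕ (marker ⊕ (flag j j≤ ⊕ payload j j≤))

    flagClear : Fin (suc (h n)) → Literal (n + certLength n)
    flagClear j = certBit (flag< (s≤s⁻¹ (toℕ<n j))) false

    branch : Fin (suc (h n)) → Branch (n + certLength n)
    branch j = flagClear j ∷ [] ⇒ call (restore (toℕ j) (s≤s⁻¹ (toℕ<n j)))

    tree : Prog (n + certLength n)
    tree = ifAll certBit z<s true ∷ [] then cascade branch else reject

  verifier : ∀ N → Prog N
  verifier N with anyUpTo? (λ n → n + certLength n ≟ N) (suc N)
  ... | yes (n , _ , e) = subst Prog e (tree n)
  ... | no  _           = reject

  eval-verifier : (w : Vec 𝔹 n) (c′ : Vec 𝔹 (certLength n)) →
                  eval (verifier _) (w ++ c′) ≡ eval (tree n) (w ++ c′)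
  eval-verifier {n} w c′
    with anyUpTo? (λ n′ → n′ + certLength n′ ≟ n + certLength n) (suc (n + certLength n))
  ... | yes (n′ , _ , e) with n+f[n]-injective certLength-mono e
  ...   | refl rewrite ≡-irrelevant e refl = refl
  eval-verifier {n} w c′ | no ∄ = contradiction (n , s≤s (m≤m+n n _) , refl) ∄

  wire-restore : ∀ (w : Vec 𝔹 n) (c′ : Vec 𝔹 (certLength n)) j j≤ →
                 c′ ‼ 0 ≡ true → c′ ‼ suc j ≡ false →
                 wire (restore n j j≤) (w ++ c′) ≡ w ⋄ wire (payload n j j≤) (w ++ c′)
  wire-restore {n} w c′ j j≤ c′₀ c′ⱼ = begin
    wire (word n ⊕ (marker n ⊕ (flag n j j≤ ⊕ payload n j j≤))) v
      ≡⟨ wire-⊕ (word n) (marker n ⊕ (flag n j j≤ ⊕ payload n j j≤)) v ⟩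
    wire (word n) v ++ wire (marker n ⊕ (flag n j j≤ ⊕ payload n j j≤)) v
      ≡⟨ cong₂ _++_ (wire-halves w c′ (m≤m+n n (certLength n)))
                    (wire-⊕ (marker n) (flag n j j≤ ⊕ payload n j j≤) v) ⟩
    double w ++ (wire (marker n) v ++ wire (flag n j j≤ ⊕ payload n j j≤) v)
      ≡⟨ cong (λ x → double w ++ (wire (marker n) v ++ x)) (wire-⊕ (flag n j j≤) (payload n j j≤) v) ⟩
    double w ++ (wire (marker n) v ++ (wire (flag n j j≤) v ++ wire (payload n j j≤) v))
      ≡⟨ cong₂ (λ x y → double w ++ (x ∷ y ∷ wire (payload n j j≤) v)) (at 0 c′₀) (at (suc j) c′ⱼ) ⟩
    w ⋄ wire (payload n j j≤) v ∎
    where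
    open ≡-Reasoning
    v = w ++ c′
    at : ∀ x {b} → c′ ‼ x ≡ b → v ‼ (n + x) ≡ b
    at x c′ₓ = trans (‼-++ʳ w c′ x) c′ₓ

  eval-tree : (w : Vec 𝔹 n) (c′ : Vec 𝔹 (certLength n)) →
              eval (tree n) (w ++ c′) ≡ (if c′ ‼ 0 then eval (cascade (branch n)) (w ++ c′) else false)
  eval-tree w c′ rewrite ‼-++ʳ w c′ 0 with c′ ‼ 0
  ... | true  = refl
  ... | false = refl

  encode : ∀ n {m} → Vec 𝔹 m → Vec 𝔹 (certLength n)
  encode n {m} c = true ∷ (tabulateℕ (suc (h n)) (_<ᵇ m) ++ tabulateℕ (h n) (c ‼_))

  encode-flag : ∀ n {m} (c : Vec 𝔹 m) {j} → j ≤ h n → encode n c ‼ suc j ≡ (j <ᵇ m)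
  encode-flag n {m} c j≤ =
    trans (‼-++ˡ (tabulateℕ (suc (h n)) (_<ᵇ m)) _ (s≤s j≤)) (‼-tabulateℕ (_<ᵇ m) (s≤s j≤))

  wire-payload-encode : ∀ (w : Vec 𝔹 n) {m} (c : Vec 𝔹 m) m≤ → wire (payload n m m≤) (w ++ encode n c) ≡ c
  wire-payload-encode {n} w {m} c m≤ = wire-ext (payload n _ m≤) (w ++ encode n c) λ {s} s<m → begin
    (w ++ encode n c) ‼ ((n + suc (suc (h n))) + s) ≡⟨ cong ((w ++ encode n c) ‼_) (+-assoc n _ s) ⟩
    (w ++ encode n c) ‼ (n + suc (suc (h n) + s))   ≡⟨ ‼-++ʳ w _ _ ⟩
    encode n c ‼ suc (suc (h n) + s)                ≡⟨ ‼-++ʳ (tabulateℕ (suc (h n)) (_<ᵇ m)) _ s ⟩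
    tabulateℕ (h n) (c ‼_) ‼ s                      ≡⟨ ‼-tabulateℕ (c ‼_) (<-≤-trans s<m m≤) ⟩
    c ‼ s                                           ∎
    where open ≡-Reasoning

  flag-set : ∀ (w : Vec 𝔹 n) {m} (c : Vec 𝔹 m) (j : Fin (suc (h n))) → toℕ j < m →
             holdsAll (w ++ encode n c) (guard (branch n j)) ≡ false
  flag-set {n} w c j j<m = single-fails (w ++ encode n c) (flagClear n j)
    (trans (‼-++ʳ w _ (suc (toℕ j))) (trans (encode-flag n c (s≤s⁻¹ (toℕ<n j))) (<⇒<ᵇ≡true j<m)))

  flag-clear : ∀ (w : Vec 𝔹 n) {m} (c : Vec 𝔹 m) (j : Fin (suc (h n))) → toℕ j ≡ m →
               holdsAll (w ++ encode n c) (guard (branch n j)) ≡ true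
  flag-clear {n} w c j refl = single-holds (w ++ encode n c) (flagClear n j)
    (trans (‼-++ʳ w _ (suc (toℕ j))) (trans (encode-flag n c (s≤s⁻¹ (toℕ<n j))) (n<ᵇn≡false (toℕ j))))

  call-restore : ∀ (w : Vec 𝔹 n) {m} (c : Vec 𝔹 m) j j≤ → j ≡ m →
                 eval (call (restore n j j≤)) (w ++ encode n c) ≡ g _ (w ⋄ c)
  call-restore {n} w c j j≤ refl = cong (g _)
    (trans (wire-restore w (encode n c) j j≤ refl (trans (encode-flag n c j≤) (n<ᵇn≡false j)))
           (cong (w ⋄_) (wire-payload-encode w c j≤)))

  tree-encode : ∀ (w : Vec 𝔹 n) {m} (c : Vec 𝔹 m) → m ≤ h n → eval (tree n) (w ++ encode n c) ≡ g _ (w ⋄ c)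
  tree-encode {n} w c m≤ = begin
    eval (tree n) (w ++ encode n c)             ≡⟨ eval-tree w (encode n c) ⟩
    eval (cascade (branch n)) (w ++ encode n c) ≡⟨ eval-cascade-first (branch n) i before (flag-clear w c i i≡m) ⟩
    eval (body (branch n i)) (w ++ encode n c)  ≡⟨ call-restore w c (toℕ i) _ i≡m ⟩
    g _ (w ⋄ c)                                 ∎
    where
    open ≡-Reasoning
    i = fromℕ< (s≤s m≤)
    i≡m = toℕ-fromℕ< (s≤s m≤)
    before : ∀ j → j <ᶠ i → holdsAll (w ++ encode n c) (guard (branch n j)) ≡ false
    before j j<i = flag-set w c j (subst (toℕ j <_) i≡m j<i)

  tree-accepts : ∀ (w : Vec 𝔹 n) c′ → eval (tree n) (w ++ c′) ≡ true → Accepts⋄ h g w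
  tree-accepts {n} w c′ accepts with c′ ‼ 0 in c′₀ | eval-tree w c′
  ... | false | tree≡ = contradiction (trans (sym tree≡) accepts) λ ()
  ... | true  | tree≡ with eval-cascade-true (branch n) (trans (sym tree≡) accepts)
  ...   | j , clear , call-accepts =
    toℕ j , wire (payload n (toℕ j) j≤) (w ++ c′) , j≤ ,
    trans (cong (g _) (sym (wire-restore w c′ (toℕ j) j≤ c′₀ c′ⱼ))) call-accepts
    where
    j≤ = s≤s⁻¹ (toℕ<n j)
    c′ⱼ = trans (sym (‼-++ʳ w c′ (suc (toℕ j)))) (single-holds⁻¹ (w ++ c′) (flagClear n j) clear)

  verifierBound : ℕ → ℕ
  verifierBound N = 2 + (suc (h N) * (2 + bound ((N + N) + (2 + h N))) + 1) + 1

  size-tree : ∀ {N} n → n ≤ N → size (tree n) ≤ verifierBound N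
  size-tree {N} n n≤N = begin
    size (tree n)                           ≡⟨ size-ifAll (certBit n z<s true ∷ []) (cascade (branch n)) reject ⟩
    2 + size (cascade (branch n)) + 1       ≤⟨ +-monoˡ-≤ 1 (+-monoʳ-≤ 2 (size-cascade (branch n) cost≤)) ⟩
    2 + (suc (h n) * B + 1) + 1             ≤⟨ +-monoˡ-≤ 1 (+-monoʳ-≤ 2 (+-monoˡ-≤ 1 (*-monoˡ-≤ B (s≤s (h-mono n≤N))))) ⟩
    verifierBound N                         ∎
    where
    open ≤-Reasoning
    B = 2 + bound ((N + N) + (2 + h N))
    cost≤ : ∀ j → cost (branch n j) ≤ B
    cost≤ j = s≤s (s≤s (size-call _
      (+-mono-≤ (+-mono-≤ n≤N n≤N) (s≤s (s≤s (≤-trans (s≤s⁻¹ (toℕ<n j)) (h-mono n≤N)))))))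

  size-verifier : ∀ N → size (verifier N) ≤ verifierBound N
  size-verifier N with anyUpTo? (λ n → n + certLength n ≟ N) (suc N)
  ... | yes (n , _ , refl) = size-tree n (m≤m+n n _)
  ... | no  _              = s≤s z≤n

NP-IS⋄⇒NP-IS : ∀ f → NP-IS⋄ f → NP-IS f
NP-IS⋄⇒NP-IS f (h , h-poly , g , g∈P , f⇔g) =
  certLength , certLength-poly , certLength-mono , (λ N → eval (verifier N)) ,
  P-IS-eval verifier size-poly size-verifier , λ n w → mk⇔ (to w) (from w)
  where
  open DecisionPrograms g∈P
  open FixedLengthVerifier h (poly-mono h-poly) g∈P

  certLength-poly : IsPolynomial certLength
  certLength-poly = poly-+ (poly-const 1) (poly-+ (poly-+ (poly-const 1) h-poly) h-poly)

  size-poly : IsPolynomial verifierBound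
  size-poly = poly-+ (poly-+ (poly-const 2) (poly-+ (poly-* (poly-+ (poly-const 1) h-poly) bound′-poly) (poly-const 1)))
                     (poly-const 1)
    where
    bound′-poly : IsPolynomial (λ N → 2 + bound ((N + N) + (2 + h N)))
    bound′-poly = poly-+ (poly-const 2)
      (poly-∘ (proj₁ (proj₂ g∈P)) (poly-+ (poly-+ poly-id poly-id) (poly-+ (poly-const 2) h-poly)))

  to : (w : Vec 𝔹 n) → f n w ≡ true → Σ (Vec 𝔹 (certLength n)) λ c′ → eval (verifier _) (w ++ c′) ≡ true
  to {n} w fw with Equivalence.to (f⇔g n w) fw
  ... | m , c , m≤ , gwc = encode n c , trans (eval-verifier w _) (trans (tree-encode w c m≤) gwc)

  from : (w : Vec 𝔹 n) → Σ (Vec 𝔹 (certLength n)) (λ c′ → eval (verifier _) (w ++ c′) ≡ true) → f n w ≡ true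
  from {n} w (c′ , accepts) =
    Equivalence.from (f⇔g n w) (tree-accepts w c′ (trans (sym (eval-verifier w c′)) accepts))

theorem11 : (f : BoolFamily) →
    NP-IS f ⇔
    (Σ (ℕ → ℕ) λ h → IsPolynomial h ×
     Σ BoolFamily λ g → P-IS g ×
     (∀ n (w : Vec 𝔹 n) →
        (f n w ≡ true) ⇔
        (Σ ℕ λ m → Σ (Vec 𝔹 m) λ c → m ≤ h n × g ((n + n) + (2 + m)) (w ⋄ c) ≡ true)))
theorem11 f = mk⇔ (NP-IS⇒NP-IS⋄ f) (NP-IS⋄⇒NP-IS f)
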